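{- Let $q$ be an odd prime power, let $n\ge 2$ be an integer, and let $Q(X,Y)=aX^2+bXY+cY^2\in \mathbb{F}_{q^n}[X,Y]$ be a nonzero quadratic form. Then the directed graph $\Gamma(Q,V)$ is undirected for every $\mathbb{F}_q$-vector subspace $V\subseteq \mathbb{F}_{q^n}$ if and only if either $a=c$, or $b=0$ and $a=-c\neq 0$.
   Context: For a quadratic form $Q\in\mathbb{F}_{q^n}[X,Y]$ and an $\mathbb{F}_q$-vector subspace $V\subseteq\mathbb{F}_{q^n}$, $\Gamma(Q,V)$ is the directed graph with vertex set $\mathbb{F}_{q^n}$ and a directed edge $x\to y$ whenever $x\neq y$ and $Q(x,y)\in V$. The graph is called undirected if for all $x,y\in\mathbb{F}_{q^n}$, either both or neither of the directed edges $x\to y$, $y\to x$ are present. -}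

module Defs where

open import Level using (Level; _⊔_)
open import Algebra.Bundles using (CommutativeRing)
open import Data.Nat as ℕ using (ℕ)
open import Data.Nat.Primality using (Prime)
open import Data.Nat.Divisibility using (_∣_)
open import Data.Fin using (Fin)
open import Data.Product using (Σ; ∃; _×_; _,_; proj₁)
open import Data.Sum using (_⊎_)
open import Relation.Nullary using (¬_)
open import Relation.Unary using (Pred)
open import Relation.Binary.Bundles using (Setoid)
import Relation.Binary.PropositionalEquality as ≡
open import Function.Bundles using (Inverse)

OddPrimePower : ℕ → Set
OddPrimePower q = Σ ℕ λ p → Σ ℕ λ k →
  Prime p × ¬ (2 ∣ p) × 1 ℕ.≤ k × q ≡.≡ p ℕ.^ k

module _ {c ℓ : Level} (R : CommutativeRing c ℓ) where
  open CommutativeRing R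

  IsField : Set (c ⊔ ℓ)
  IsField = ¬ (1# ≈ 0#) × (∀ x → ¬ (x ≈ 0#) → Σ Carrier λ y → x * y ≈ 1#)

  HasCard : ∀ {a e} → Setoid a e → ℕ → Set (a ⊔ e)
  HasCard S N = Inverse S (≡.setoid (Fin N))

  subSetoid : ∀ {k} → Pred Carrier k → Setoid (c ⊔ k) ℓ
  subSetoid K = record
    { Carrier = Σ Carrier K
    ; _≈_ = λ u v → proj₁ u ≈ proj₁ v
    ; isEquivalence = record
      { refl = refl ; sym = sym ; trans = trans } }

  record IsSubfield {k} (K : Pred Carrier k) : Set (c ⊔ ℓ ⊔ k) where
    field
      resp  : ∀ {x y} → x ≈ y → K x → K y
      zero∈ : K 0#
      one∈  : K 1#
      +∈    : ∀ {x y} → K x → K y → K (x + y)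
      -∈    : ∀ {x} → K x → K (- x)
      *∈    : ∀ {x y} → K x → K y → K (x * y)
      inv∈  : ∀ {x y} → K x → x * y ≈ 1# → K y

  record IsSubspace {k v} (K : Pred Carrier k) (V : Pred Carrier v)
         : Set (c ⊔ ℓ ⊔ k ⊔ v) where
    field
      resp   : ∀ {x y} → x ≈ y → V x → V y
      zero∈  : V 0#
      +∈     : ∀ {x y} → V x → V y → V (x + y)
      scale∈ : ∀ {λ' x} → K λ' → V x → V (λ' * x)

  quadForm : Carrier → Carrier → Carrier → Carrier → Carrier → Carrier
  quadForm a b c' x y = a * (x * x) + b * (x * y) + c' * (y * y)

  Edge : ∀ {v} → (Carrier → Carrier → Carrier) → Pred Carrier v →
         Carrier → Carrier → Set (ℓ ⊔ v)
  Edge Q V x y = ¬ (x ≈ y) × V (Q x y)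

  Undirected : ∀ {v} → (Carrier → Carrier → Carrier) → Pred Carrier v → Set (c ⊔ ℓ ⊔ v)
  Undirected Q V = ∀ x y → (Edge Q V x y → Edge Q V y x) × (Edge Q V y x → Edge Q V x y)

  UndirectedForAllSubspaces : ∀ {k} (v : Level) → Pred Carrier k →
    Carrier → Carrier → Carrier → Set (c ⊔ ℓ ⊔ k ⊔ Level.suc v)
  UndirectedForAllSubspaces v K a b c' =
    ∀ (V : Pred Carrier v) → IsSubspace K V → Undirected (quadForm a b c') V

  CoeffCondition : Carrier → Carrier → Carrier → Set ℓ
  CoeffCondition a b c' = a ≈ c' ⊎ (b ≈ 0# × a ≈ - c' × ¬ (a ≈ 0#))

{-# OPTIONS --safe #-}
-- If a ≈ c' the form is symmetric, and if b ≈ 0 and a ≈ - c' it is skew-symmetric, so Q(y,x) is a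
-- K-multiple of Q(x,y) and every subspace contains both or neither. Conversely, taking V = K·Q(x,y)
-- shows that Q(y,x) ∈ K·Q(x,y) whenever x ≠ y. Suppose a ≠ c'. At (1,0) this gives c' = κa with
-- κ ∈ K, and at (s,1) with s² ≠ 1, as Q(1,s) − Q(s,1) = (c' − a)(s² − 1) ≠ 0, it gives
-- Q(s,1) ∈ K·(c' − a)(s² − 1). Adding these at t and −t for some t ∉ K (there is one since q < qⁿ)
-- yields t² ∈ K or κ = −1. Since 2 ≠ 0 (q is odd), t² and (t+1)² are not both in K, so κ = −1,
-- i.e. a = −c'. Then b·s ∈ K·a(s² − 1), and if b ≠ 0, comparing s = t with s = t² shows
-- t + t⁻¹ ∈ K for every t ∉ K; for t = u ± 1 with u ∉ K this forces u ∈ K.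
module Submission where

open import Defs
open import Level using (Level; _⊔_)
open import Algebra.Bundles using (CommutativeRing)
open import Data.Nat as ℕ using (ℕ; zero; suc)
import Data.Nat.Properties as ℕ
open import Data.Nat.Divisibility using (_∣_; divides; ∣1⇒≡1)
open import Data.Nat.Primality using (prime[2]; prime⇒nonTrivial; euclidsLemma)
open import Data.Integer as ℤ using (ℤ; +_; -[1+_]; _⊖_)
import Data.Integer.Properties as ℤ
open import Data.Fin as Fin using (Fin)
import Data.Fin.Properties as Fin
import Data.Fin.Permutation as Permutation
open import Algebra.Properties.CommutativeMonoid.Sum ℕ.+-0-commutativeMonoid
  using (sum-syntax; sum-cong-≗; ∑-distrib-+; ∑-permute)
open import Data.Bool.Base using (if_then_else_)
open import Data.Maybe using (Maybe; just; nothing)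
open import Data.Product as Product using (Σ; _×_; _,_; proj₁; proj₂)
open import Data.Sum using (_⊎_; inj₁; inj₂; [_,_]′; map₂)
open import Data.Empty using (⊥-elim)
open import Function using (_∘_; id)
open import Function.Bundles using (_⇔_; mk⇔; Inverse)
open import Relation.Nullary using (¬_; yes; no; does; contradiction)
open import Relation.Nullary.Decidable using (dec-true; dec-false; map′)
open import Relation.Unary using (Pred; _∈_)
import Relation.Unary as Unary
open import Relation.Binary.Definitions using (Decidable; tri<; tri≈; tri>)
open import Relation.Binary.PropositionalEquality as ≡ using (_≡_; _≢_)
import Algebra.Solver.Ring
import Algebra.Solver.Ring.AlmostCommutativeRing as ACR

-- Cancellations among coefficients must compute for the solver's refl, so coefficients are
-- integers mapped into L. With the optimised multiple _×′_, ⟦ + 1 ⟧ℤ and ⟦ + 2 ⟧ℤ are literally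
-- 1# and 1# + 1#, as they appear in the statements below.
module IntegerRingSolver {c ℓ} (L : CommutativeRing c ℓ) where
  open CommutativeRing L
  open import Algebra.Properties.Ring ring
    using (-0#≈0#; -‿involutive; -‿+-comm; -‿distribˡ-*; -‿distribʳ-*)
  open import Algebra.Properties.Semiring.Mult.TCOptimised semiring
    using (×-homo-+; ×1-homo-*) renaming (_×_ to _×′_)
  open import Relation.Binary.Reasoning.Setoid setoid

  ⟦_⟧ℤ : ℤ → Carrier
  ⟦ + n ⟧ℤ = n ×′ 1#
  ⟦ -[1+ n ] ⟧ℤ = - (suc n ×′ 1#)

  ⟦⟧ℤ-neg : ∀ i → ⟦ ℤ.- i ⟧ℤ ≈ - ⟦ i ⟧ℤ
  ⟦⟧ℤ-neg (+ zero) = sym -0#≈0#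
  ⟦⟧ℤ-neg (+ suc n) = refl
  ⟦⟧ℤ-neg -[1+ n ] = sym (-‿involutive _)

  ⟦⟧ℤ-⊖ : ∀ m n → ⟦ m ⊖ n ⟧ℤ ≈ m ×′ 1# - n ×′ 1#
  ⟦⟧ℤ-⊖ m zero = begin
    ⟦ m ⊖ 0 ⟧ℤ          ≡⟨ ≡.cong ⟦_⟧ℤ (ℤ.⊖-≥ {m} ℕ.z≤n) ⟩
    m ×′ 1#             ≈⟨ +-identityʳ _ ⟨
    m ×′ 1# + 0#        ≈⟨ +-congˡ -0#≈0# ⟨
    m ×′ 1# - 0 ×′ 1#   ∎
  ⟦⟧ℤ-⊖ zero (suc n) = sym (+-identityˡ _)
  ⟦⟧ℤ-⊖ (suc m) (suc n) = begin
    ⟦ suc m ⊖ suc n ⟧ℤ                ≡⟨ ≡.cong ⟦_⟧ℤ (ℤ.[1+m]⊖[1+n]≡m⊖n m n) ⟩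
    ⟦ m ⊖ n ⟧ℤ                        ≈⟨ ⟦⟧ℤ-⊖ m n ⟩
    m ×′ 1# - n ×′ 1#                 ≈⟨ shift (m ×′ 1#) (n ×′ 1#) ⟩
    (1# + m ×′ 1#) - (1# + n ×′ 1#)   ≈⟨ +-cong (×-homo-+ 1# 1 m) (-‿cong (×-homo-+ 1# 1 n)) ⟨
    suc m ×′ 1# - suc n ×′ 1#         ∎
    where
    shift : ∀ x y → x - y ≈ (1# + x) - (1# + y)
    shift x y = sym (begin
      (1# + x) - (1# + y)        ≈⟨ +-cong (+-comm x 1#) (-‿+-comm 1# y) ⟨
      (x + 1#) + (- 1# + - y)    ≈⟨ +-assoc x 1# _ ⟩
      x + (1# + (- 1# + - y))    ≈⟨ +-congˡ (+-assoc 1# (- 1#) (- y)) ⟨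
      x + ((1# - 1#) + - y)      ≈⟨ +-congˡ (+-congʳ (-‿inverseʳ 1#)) ⟩
      x + (0# + - y)             ≈⟨ +-congˡ (+-identityˡ (- y)) ⟩
      x - y                      ∎)

  ⟦⟧ℤ-+ : ∀ i j → ⟦ i ℤ.+ j ⟧ℤ ≈ ⟦ i ⟧ℤ + ⟦ j ⟧ℤ
  ⟦⟧ℤ-+ (+ m) (+ n) = ×-homo-+ 1# m n
  ⟦⟧ℤ-+ (+ m) -[1+ n ] = ⟦⟧ℤ-⊖ m (suc n)
  ⟦⟧ℤ-+ -[1+ m ] (+ n) = trans (⟦⟧ℤ-⊖ n (suc m)) (+-comm _ _)
  ⟦⟧ℤ-+ -[1+ m ] -[1+ n ] = begin
    - (suc (suc m ℕ.+ n) ×′ 1#)         ≡⟨ ≡.cong (λ k → - (suc k ×′ 1#)) (ℕ.+-suc m n) ⟨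
    - ((suc m ℕ.+ suc n) ×′ 1#)         ≈⟨ -‿cong (×-homo-+ 1# (suc m) (suc n)) ⟩
    - (suc m ×′ 1# + suc n ×′ 1#)       ≈⟨ -‿+-comm _ _ ⟨
    - (suc m ×′ 1#) + - (suc n ×′ 1#)   ∎

  ⟦⟧ℤ-*-nonneg : ∀ m j → ⟦ + m ℤ.* j ⟧ℤ ≈ m ×′ 1# * ⟦ j ⟧ℤ
  ⟦⟧ℤ-*-nonneg m (+ n) = begin
    ⟦ + m ℤ.* + n ⟧ℤ    ≡⟨ ≡.cong ⟦_⟧ℤ (ℤ.+◃n≡+n (m ℕ.* n)) ⟩
    (m ℕ.* n) ×′ 1#     ≈⟨ ×1-homo-* m n ⟩
    m ×′ 1# * n ×′ 1#   ∎
  ⟦⟧ℤ-*-nonneg m -[1+ n ] = begin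
    ⟦ + m ℤ.* ℤ.- + suc n ⟧ℤ     ≡⟨ ≡.cong ⟦_⟧ℤ (ℤ.neg-distribʳ-* (+ m) (+ suc n)) ⟨
    ⟦ ℤ.- (+ m ℤ.* + suc n) ⟧ℤ   ≈⟨ ⟦⟧ℤ-neg (+ m ℤ.* + suc n) ⟩
    - ⟦ + m ℤ.* + suc n ⟧ℤ       ≈⟨ -‿cong (⟦⟧ℤ-*-nonneg m (+ suc n)) ⟩
    - (m ×′ 1# * suc n ×′ 1#)    ≈⟨ -‿distribʳ-* _ _ ⟩
    m ×′ 1# * - (suc n ×′ 1#)    ∎

  ⟦⟧ℤ-* : ∀ i j → ⟦ i ℤ.* j ⟧ℤ ≈ ⟦ i ⟧ℤ * ⟦ j ⟧ℤ
  ⟦⟧ℤ-* (+ m) j = ⟦⟧ℤ-*-nonneg m j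
  ⟦⟧ℤ-* -[1+ m ] j = begin
    ⟦ ℤ.- + suc m ℤ.* j ⟧ℤ     ≡⟨ ≡.cong ⟦_⟧ℤ (ℤ.neg-distribˡ-* (+ suc m) j) ⟨
    ⟦ ℤ.- (+ suc m ℤ.* j) ⟧ℤ   ≈⟨ ⟦⟧ℤ-neg (+ suc m ℤ.* j) ⟩
    - ⟦ + suc m ℤ.* j ⟧ℤ       ≈⟨ -‿cong (⟦⟧ℤ-*-nonneg (suc m) j) ⟩
    - (suc m ×′ 1# * ⟦ j ⟧ℤ)   ≈⟨ -‿distribˡ-* _ _ ⟩
    - (suc m ×′ 1#) * ⟦ j ⟧ℤ   ∎

  ℤ⟶L : ℤ.+-*-rawRing ACR.-Raw-AlmostCommutative⟶ ACR.fromCommutativeRing L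
  ℤ⟶L = record
    { ⟦_⟧ = ⟦_⟧ℤ ; +-homo = ⟦⟧ℤ-+ ; *-homo = ⟦⟧ℤ-* ; -‿homo = ⟦⟧ℤ-neg
    ; 0-homo = refl ; 1-homo = refl }

  coefficients≟ : ∀ i j → Maybe (⟦ i ⟧ℤ ≈ ⟦ j ⟧ℤ)
  coefficients≟ i j with i ℤ.≟ j
  ... | yes ≡.refl = just refl
  ... | no _       = nothing

  open Algebra.Solver.Ring ℤ.+-*-rawRing (ACR.fromCommutativeRing L) ℤ⟶L
    coefficients≟ public

  0ₚ 1ₚ 2ₚ : ∀ {m} → Polynomial m
  0ₚ = con (+ 0)
  1ₚ = con (+ 1)
  2ₚ = con (+ 2)

  quadFormₚ : ∀ {m} → (a b c x y : Polynomial m) → Polynomial m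
  quadFormₚ a b c x y = a :* (x :* x) :+ b :* (x :* y) :+ c :* (y :* y)

-- An equation follows from hypotheses lᵢ ≈ rᵢ once the difference of its sides is written as
-- a combination of the lᵢ - rᵢ, which is a ring identity left to the solver.
module LinearCombination {c ℓ} (L : CommutativeRing c ℓ) where
  open CommutativeRing L
  open import Algebra.Properties.Ring ring using (x≈y⇒x∙y⁻¹≈ε; x∙y⁻¹≈ε⇒x≈y)

  private
    multiple≈0 : ∀ g {l r} → l ≈ r → g * (l - r) ≈ 0#
    multiple≈0 g l≈r = trans (*-congˡ (x≈y⇒x∙y⁻¹≈ε l≈r)) (zeroʳ g)

  linear-combination₁ : ∀ {x y l₁ r₁} g₁ →
    x - y ≈ g₁ * (l₁ - r₁) → l₁ ≈ r₁ → x ≈ y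
  linear-combination₁ g₁ x-y≈ e₁ = x∙y⁻¹≈ε⇒x≈y _ _ (trans x-y≈ (multiple≈0 g₁ e₁))

  linear-combination₂ : ∀ {x y l₁ r₁ l₂ r₂} g₁ g₂ →
    x - y ≈ g₁ * (l₁ - r₁) + g₂ * (l₂ - r₂) → l₁ ≈ r₁ → l₂ ≈ r₂ → x ≈ y
  linear-combination₂ g₁ g₂ x-y≈ e₁ e₂ = x∙y⁻¹≈ε⇒x≈y _ _
    (trans x-y≈ (trans (+-cong (multiple≈0 g₁ e₁) (multiple≈0 g₂ e₂)) (+-identityʳ 0#)))

  linear-combination₃ : ∀ {x y l₁ r₁ l₂ r₂ l₃ r₃} g₁ g₂ g₃ →
    x - y ≈ g₁ * (l₁ - r₁) + g₂ * (l₂ - r₂) + g₃ * (l₃ - r₃) →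
    l₁ ≈ r₁ → l₂ ≈ r₂ → l₃ ≈ r₃ → x ≈ y
  linear-combination₃ g₁ g₂ g₃ x-y≈ e₁ e₂ e₃ = x∙y⁻¹≈ε⇒x≈y _ _
    (trans x-y≈ (trans (+-cong (+-cong (multiple≈0 g₁ e₁) (multiple≈0 g₂ e₂)) (multiple≈0 g₃ e₃))
                       (trans (+-identityʳ _) (+-identityʳ 0#))))

module DecidableField {c ℓ} (L : CommutativeRing c ℓ) (isField : IsField L)
  (_≟_ : Decidable (CommutativeRing._≈_ L)) where
  open CommutativeRing L
  open import Algebra.Properties.Ring ring
    using (x[y-z]≈xy-xz; x≈y⇒x∙y⁻¹≈ε; x∙y⁻¹≈ε⇒x≈y; +-inverseˡ-unique)
  open import Relation.Binary.Reasoning.Setoid setoid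
  open IntegerRingSolver L
  open LinearCombination L

  1≉0 : ¬ 1# ≈ 0#
  1≉0 = proj₁ isField

  inverse : ∀ {x} → ¬ x ≈ 0# → Σ Carrier λ x⁻¹ → x * x⁻¹ ≈ 1#
  inverse = proj₂ isField _

  inverse-cancelˡ : ∀ {x x⁻¹} → x * x⁻¹ ≈ 1# → ∀ z → x⁻¹ * (x * z) ≈ z
  inverse-cancelˡ {x} {x⁻¹} xx⁻¹≈1 z = linear-combination₁ z
    (solve 3 (λ x x⁻¹ z → x⁻¹ :* (x :* z) :- z := z :* (x :* x⁻¹ :- 1ₚ)) refl x x⁻¹ z)
    xx⁻¹≈1

  zero-product : ∀ {x y} → x * y ≈ 0# → x ≈ 0# ⊎ y ≈ 0#
  zero-product {x} {y} xy≈0 with x ≟ 0#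
  ... | yes x≈0 = inj₁ x≈0
  ... | no x≉0 with inverse x≉0
  ...   | x⁻¹ , xx⁻¹≈1 = inj₂ (begin
    y              ≈⟨ inverse-cancelˡ xx⁻¹≈1 y ⟨
    x⁻¹ * (x * y)  ≈⟨ *-congˡ xy≈0 ⟩
    x⁻¹ * 0#       ≈⟨ zeroʳ x⁻¹ ⟩
    0#             ∎)

  *-nonzero : ∀ {x y} → ¬ x ≈ 0# → ¬ y ≈ 0# → ¬ x * y ≈ 0#
  *-nonzero x≉0 y≉0 = [ x≉0 , y≉0 ]′ ∘ zero-product

  *-cancelˡ-nonzero : ∀ {a x y} → ¬ a ≈ 0# → a * x ≈ a * y → x ≈ y
  *-cancelˡ-nonzero {a} {x} {y} a≉0 ax≈ay
    with zero-product (trans (x[y-z]≈xy-xz a x y) (x≈y⇒x∙y⁻¹≈ε ax≈ay))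
  ... | inj₁ a≈0   = contradiction a≈0 a≉0
  ... | inj₂ x-y≈0 = x∙y⁻¹≈ε⇒x≈y x y x-y≈0

  factorˡ≉0 : ∀ {m x y} → m * x ≈ y → ¬ y ≈ 0# → ¬ m ≈ 0#
  factorˡ≉0 {x = x} mx≈y y≉0 m≈0 = y≉0 (trans (sym mx≈y) (trans (*-congʳ m≈0) (zeroˡ x)))

  square≈1⇒±1 : ∀ {x} → x * x ≈ 1# → x ≈ 1# ⊎ x ≈ - 1#
  square≈1⇒±1 {x} x²≈1
    with zero-product (trans (solve 1 (λ x → (x :- 1ₚ) :* (x :+ 1ₚ) := x :* x :- 1ₚ) refl x)
                             (x≈y⇒x∙y⁻¹≈ε x²≈1))
  ... | inj₁ x-1≈0 = inj₁ (x∙y⁻¹≈ε⇒x≈y x 1# x-1≈0)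
  ... | inj₂ x+1≈0 = inj₂ (+-inverseˡ-unique x 1# x+1≈0)

module Lines {c ℓ k} (L : CommutativeRing c ℓ) (K : Pred (CommutativeRing.Carrier L) k)
  (isK : IsSubfield L K) where
  open CommutativeRing L
  module K = IsSubfield isK
  open IntegerRingSolver L
  open LinearCombination L

  ⟨_⟩ : Carrier → Pred Carrier (c ⊔ ℓ ⊔ k)
  ⟨ w ⟩ z = Σ Carrier λ l → K l × z ≈ l * w

  ⟨⟩-isSubspace : ∀ w → IsSubspace L K ⟨ w ⟩
  ⟨⟩-isSubspace w = record
    { resp   = λ { x≈y (l , l∈K , x≈lw) → l , l∈K , trans (sym x≈y) x≈lw }
    ; zero∈  = 0# , K.zero∈ , sym (zeroˡ w)
    ; +∈     = λ { (l , l∈K , x≈lw) (m , m∈K , y≈mw) →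
                   l + m , K.+∈ l∈K m∈K , trans (+-cong x≈lw y≈mw) (sym (distribʳ w l m)) }
    ; scale∈ = λ { {λ'} λ'∈K (l , l∈K , x≈lw) →
                   λ' * l , K.*∈ λ'∈K l∈K , trans (*-congˡ x≈lw) (sym (*-assoc λ' l w)) }
    }

  ∈⟨⟩-resp : ∀ {x x' w w'} → x ≈ x' → w ≈ w' → x ∈ ⟨ w ⟩ → x' ∈ ⟨ w' ⟩
  ∈⟨⟩-resp x≈x' w≈w' (l , l∈K , x≈lw) = l , l∈K , trans (sym x≈x') (trans x≈lw (*-congˡ w≈w'))

  ∈⟨⟩-trans : ∀ {x w y} → x ∈ ⟨ w ⟩ → w ∈ ⟨ y ⟩ → x ∈ ⟨ y ⟩
  ∈⟨⟩-trans {y = y} (l , l∈K , x≈lw) (m , m∈K , w≈my) =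
    l * m , K.*∈ l∈K m∈K , trans x≈lw (trans (*-congˡ w≈my) (sym (*-assoc l m y)))

  SwapProportional : (Carrier → Carrier → Carrier) → Set (c ⊔ ℓ ⊔ k)
  SwapProportional Q = ∀ x y → ¬ x ≈ y → Q y x ∈ ⟨ Q x y ⟩

  undirected⇒swapProportional : ∀ {a b c'} → UndirectedForAllSubspaces L (c ⊔ ℓ ⊔ k) K a b c' →
    SwapProportional (quadForm L a b c')
  undirected⇒swapProportional {a} {b} {c'} undirected x y x≉y =
    proj₂ (proj₁ (undirected ⟨ Q x y ⟩ (⟨⟩-isSubspace (Q x y)) x y)
                 (x≉y , 1# , K.one∈ , sym (*-identityˡ (Q x y))))
    where
    Q : Carrier → Carrier → Carrier
    Q = quadForm L a b c'

  coeffCondition⇒undirected : ∀ {v a b c'} → CoeffCondition L a b c' →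
    UndirectedForAllSubspaces L v K a b c'
  coeffCondition⇒undirected {a = a} {b} {c'} condition V V-subspace x y = reverse x y , reverse y x
    where
    module V = IsSubspace V-subspace
    Q : Carrier → Carrier → Carrier
    Q = quadForm L a b c'
    swap-∈V : CoeffCondition L a b c' → ∀ {x y} → V (Q x y) → V (Q y x)
    swap-∈V (inj₁ a≈c') {x} {y} = V.resp (linear-combination₁ (x * x - y * y)
      (solve 5 (λ a b c x y → quadFormₚ a b c x y :- quadFormₚ a b c y x
                              := (x :* x :- y :* y) :* (a :- c))
             refl a b c' x y)
      a≈c')
    swap-∈V (inj₂ (b≈0 , a≈-c' , _)) {x} {y} = V.resp -Q[x,y]≈Q[y,x] ∘ V.scale∈ (K.-∈ K.one∈)
      where
      -Q[x,y]≈Q[y,x] : - 1# * Q x y ≈ Q y x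
      -Q[x,y]≈Q[y,x] = sym (linear-combination₂ (y * x + x * y) (x * x + y * y)
        (solve 5 (λ a b c x y → quadFormₚ a b c y x :- (:- 1ₚ) :* quadFormₚ a b c x y
                   := (y :* x :+ x :* y) :* (b :- 0ₚ) :+ (x :* x :+ y :* y) :* (a :- (:- c)))
               refl a b c' x y)
        b≈0 a≈-c')
    reverse : ∀ x y → Edge L Q V x y → Edge L Q V y x
    reverse x y (x≉y , Qxy∈V) = x≉y ∘ sym , swap-∈V condition Qxy∈V

module DecidableSubfield {c ℓ k} (L : CommutativeRing c ℓ) (isField : IsField L)
  (_≟_ : Decidable (CommutativeRing._≈_ L))
  (K : Pred (CommutativeRing.Carrier L) k) (isK : IsSubfield L K) where
  open CommutativeRing L
  open import Algebra.Properties.Ring ring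
    using (-‿involutive; +-inverseˡ-unique; +-inverseʳ-unique; x∙y⁻¹≈ε⇒x≈y)
  open import Relation.Binary.Reasoning.Setoid setoid
  open IntegerRingSolver L
  open LinearCombination L
  open DecidableField L isField _≟_
  open Lines L K isK

  2∈K : K (1# + 1#)
  2∈K = K.+∈ K.one∈ K.one∈

  ∉K⇒≉0 : ∀ {t} → ¬ K t → ¬ t ≈ 0#
  ∉K⇒≉0 t∉K t≈0 = t∉K (K.resp (sym t≈0) K.zero∈)

  ∉K-+ : ∀ {t r} → ¬ K t → K r → ¬ K (t + r)
  ∉K-+ {t} {r} t∉K r∈K t+r∈K =
    t∉K (K.resp (solve 2 (λ t r → t :+ r :- r := t) refl t r) (K.+∈ t+r∈K (K.-∈ r∈K)))

  ∉K-neg : ∀ {t} → ¬ K t → ¬ K (- t)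
  ∉K-neg {t} t∉K -t∈K = t∉K (K.resp (-‿involutive t) (K.-∈ -t∈K))

  ∉K⇒square≉1 : ∀ {t} → ¬ K t → ¬ t * t ≈ 1#
  ∉K⇒square≉1 t∉K t²≈1 with square≈1⇒±1 t²≈1
  ... | inj₁ t≈1  = t∉K (K.resp (sym t≈1) K.one∈)
  ... | inj₂ t≈-1 = t∉K (K.resp (sym t≈-1) (K.-∈ K.one∈))

  ∉K⇒t⁴≉1 : ∀ {t} → ¬ K t → ¬ t * t ≈ - 1# → ¬ (t * t) * (t * t) ≈ 1#
  ∉K⇒t⁴≉1 t∉K t²≉-1 = [ ∉K⇒square≉1 t∉K , t²≉-1 ]′ ∘ square≈1⇒±1

  ∈K-cancelˡ : ∀ {m z} → K m → ¬ m ≈ 0# → K (m * z) → K z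
  ∈K-cancelˡ {m} {z} m∈K m≉0 mz∈K with inverse m≉0
  ... | m⁻¹ , mm⁻¹≈1 = K.resp (inverse-cancelˡ mm⁻¹≈1 z) (K.*∈ (K.inv∈ m∈K mm⁻¹≈1) mz∈K)

  ∈⟨⟩-cancelˡ : ∀ {m x y} → K m → ¬ m ≈ 0# → m * x ≈ y → x ∈ ⟨ y ⟩
  ∈⟨⟩-cancelˡ {m} {x} {y} m∈K m≉0 mx≈y with inverse m≉0
  ... | m⁻¹ , mm⁻¹≈1 = m⁻¹ , K.inv∈ m∈K mm⁻¹≈1 , (begin
    x              ≈⟨ inverse-cancelˡ mm⁻¹≈1 x ⟨
    m⁻¹ * (m * x)  ≈⟨ *-congˡ mx≈y ⟩
    m⁻¹ * y        ∎)

  ∈K⊎trivial-relation : ∀ {A B z} → K A → K B → A * z + B ≈ 0# → K z ⊎ (A ≈ 0# × B ≈ 0#)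
  ∈K⊎trivial-relation {A} {B} {z} A∈K B∈K Az+B≈0 with A ≟ 0#
  ... | no A≉0 =
    inj₁ (∈K-cancelˡ A∈K A≉0 (K.resp (sym (+-inverseˡ-unique (A * z) B Az+B≈0)) (K.-∈ B∈K)))
  ... | yes A≈0 = inj₂ (A≈0 , (begin
    B           ≈⟨ +-identityˡ B ⟨
    0# + B      ≈⟨ +-congʳ (trans (*-congʳ A≈0) (zeroˡ z)) ⟨
    A * z + B   ≈⟨ Az+B≈0 ⟩
    0#          ∎))

  module _ (2≉0 : ¬ 1# + 1# ≈ 0#) where

    2x≈0⇒x≈0 : ∀ {x} → (1# + 1#) * x ≈ 0# → x ≈ 0#
    2x≈0⇒x≈0 = [ ⊥-elim ∘ 2≉0 , id ]′ ∘ zero-product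

    squares∈K⇒∈K : ∀ {t} → K (t * t) → K ((t + 1#) * (t + 1#)) → K t
    squares∈K⇒∈K {t} t²∈K [t+1]²∈K = ∈K-cancelˡ 2∈K 2≉0
      (K.resp (solve 1 (λ t → (t :+ 1ₚ) :* (t :+ 1ₚ) :- t :* t :- 1ₚ := 2ₚ :* t) refl t)
              (K.+∈ (K.+∈ [t+1]²∈K (K.-∈ t²∈K)) (K.-∈ K.one∈)))

    -- t * t + 1# ∈ ⟨ t ⟩ says that t + t⁻¹ ∈ K.
    reciprocal-sums∈K⇒∈K : ∀ {u} → (u + 1#) * (u + 1#) + 1# ∈ ⟨ u + 1# ⟩ →
      (u - 1#) * (u - 1#) + 1# ∈ ⟨ u - 1# ⟩ → K u
    reciprocal-sums∈K⇒∈K {u} (s , s∈K , e₊) (s' , s'∈K , e₋) =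
      [ id , u≈0⇒u∈K ∘ u≈0 ∘ s≈2 ]′ (∈K⊎trivial-relation A∈K B∈K relation)
      where
      A B : Carrier
      A = (1# + 1#) + (1# + 1#) - s + s'
      B = - (s + s')
      A∈K : K A
      A∈K = K.+∈ (K.+∈ (K.+∈ 2∈K 2∈K) (K.-∈ s∈K)) s'∈K
      B∈K : K B
      B∈K = K.-∈ (K.+∈ s∈K s'∈K)
      relation : A * u + B ≈ 0#
      relation = linear-combination₂ 1# (- 1#)
        (solve 3 (λ u s s' → (2ₚ :+ 2ₚ :- s :+ s') :* u :+ (:- (s :+ s')) :- 0ₚ
            := 1ₚ :* ((u :+ 1ₚ) :* (u :+ 1ₚ) :+ 1ₚ :- s :* (u :+ 1ₚ))
               :+ (:- 1ₚ) :* ((u :- 1ₚ) :* (u :- 1ₚ) :+ 1ₚ :- s' :* (u :- 1ₚ))) refl u s s')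
        e₊ e₋
      s≈2 : A ≈ 0# × B ≈ 0# → s - (1# + 1#) ≈ 0#
      s≈2 (A≈0 , B≈0) = 2x≈0⇒x≈0 (linear-combination₂ (- 1#) (- 1#)
        (solve 2 (λ s s' → 2ₚ :* (s :- 2ₚ) :- 0ₚ
                   := (:- 1ₚ) :* ((2ₚ :+ 2ₚ :- s :+ s') :- 0ₚ) :+ (:- 1ₚ) :* ((:- (s :+ s')) :- 0ₚ))
               refl s s')
        A≈0 B≈0)
      u≈0 : s - (1# + 1#) ≈ 0# → u ≈ 0#
      u≈0 = [ id , id ]′ ∘ zero-product ∘ linear-combination₂ 1# (u + 1#)
        (solve 2 (λ u s → u :* u :- 0ₚ
                   := 1ₚ :* ((u :+ 1ₚ) :* (u :+ 1ₚ) :+ 1ₚ :- s :* (u :+ 1ₚ))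
                      :+ (u :+ 1ₚ) :* (s :- 2ₚ :- 0ₚ))
               refl u s)
        e₊
      u≈0⇒u∈K : u ≈ 0# → K u
      u≈0⇒u∈K u≈0 = K.resp (sym u≈0) K.zero∈

    module SwapProportionalForm {u} (u∉K : ¬ K u) {a b c'}
      (swap : SwapProportional (quadForm L a b c')) (a≉c' : ¬ a ≈ c') where

      Q : Carrier → Carrier → Carrier
      Q = quadForm L a b c'

      c∈⟨a⟩ : c' ∈ ⟨ a ⟩
      c∈⟨a⟩ = ∈⟨⟩-resp (solve 3 (λ a b c → quadFormₚ a b c 0ₚ 1ₚ := c) refl a b c')
                       (solve 3 (λ a b c → quadFormₚ a b c 1ₚ 0ₚ := a) refl a b c')
                       (swap 1# 0# 1≉0)

      κ : Carrier
      κ = proj₁ c∈⟨a⟩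

      κ∈K : K κ
      κ∈K = proj₁ (proj₂ c∈⟨a⟩)

      c≈κa : c' ≈ κ * a
      c≈κa = proj₂ (proj₂ c∈⟨a⟩)

      a≉0 : ¬ a ≈ 0#
      a≉0 a≈0 = a≉c' (trans a≈0 (sym (trans c≈κa (trans (*-congˡ a≈0) (zeroʳ κ)))))

      Q[s,1]∈⟨[c-a][s²-1]⟩ : ∀ {s} → ¬ s * s ≈ 1# → Q s 1# ∈ ⟨ (c' - a) * (s * s - 1#) ⟩
      Q[s,1]∈⟨[c-a][s²-1]⟩ {s} s²≉1 = from-ratio (swap s 1# s≉1)
        where
        s≉1 : ¬ s ≈ 1#
        s≉1 s≈1 = s²≉1 (trans (*-cong s≈1 s≈1) (*-identityˡ 1#))
        [c-a][s²-1]≉0 : ¬ (c' - a) * (s * s - 1#) ≈ 0#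
        [c-a][s²-1]≉0 =
          *-nonzero (a≉c' ∘ sym ∘ x∙y⁻¹≈ε⇒x≈y c' a) (s²≉1 ∘ x∙y⁻¹≈ε⇒x≈y (s * s) 1#)
        from-ratio : Q 1# s ∈ ⟨ Q s 1# ⟩ → Q s 1# ∈ ⟨ (c' - a) * (s * s - 1#) ⟩
        from-ratio (l , l∈K , Q[1,s]≈lQ[s,1]) =
          ∈⟨⟩-cancelˡ (K.+∈ l∈K (K.-∈ K.one∈)) (factorˡ≉0 [l-1]Q[s,1]≈ [c-a][s²-1]≉0)
                      [l-1]Q[s,1]≈
          where
          [l-1]Q[s,1]≈ : (l - 1#) * Q s 1# ≈ (c' - a) * (s * s - 1#)
          [l-1]Q[s,1]≈ = linear-combination₁ (- 1#)
            (solve 5 (λ a b c s l → (l :- 1ₚ) :* quadFormₚ a b c s 1ₚ :- (c :- a) :* (s :* s :- 1ₚ)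
                       := (:- 1ₚ) :* (quadFormₚ a b c 1ₚ s :- l :* quadFormₚ a b c s 1ₚ))
                   refl a b c' s l)
            Q[1,s]≈lQ[s,1]

      square∈K⊎κ≈-1 : ∀ {t} → ¬ K t → K (t * t) ⊎ κ + 1# ≈ 0#
      square∈K⊎κ≈-1 {t} t∉K = from-ratios (Q[s,1]∈⟨[c-a][s²-1]⟩ (∉K⇒square≉1 t∉K))
                                           (Q[s,1]∈⟨[c-a][s²-1]⟩ (∉K⇒square≉1 (∉K-neg t∉K)))
        where
        from-ratios : Q t 1# ∈ ⟨ (c' - a) * (t * t - 1#) ⟩ →
                      Q (- t) 1# ∈ ⟨ (c' - a) * (- t * - t - 1#) ⟩ → K (t * t) ⊎ κ + 1# ≈ 0#
        from-ratios (ν₁ , ν₁∈K , e₁) (ν₂ , ν₂∈K , e₂) =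
          map₂ κ+1≈0
            (∈K⊎trivial-relation (K.+∈ 2∈K (K.-∈ σ∈K)) (K.+∈ (K.*∈ 2∈K κ∈K) σ∈K) relation)
          where
          σ : Carrier
          σ = (ν₁ + ν₂) * (κ - 1#)
          σ∈K : K σ
          σ∈K = K.*∈ (K.+∈ ν₁∈K ν₂∈K) (K.+∈ κ∈K (K.-∈ K.one∈))
          -- The b-terms cancel: Q t 1# + Q (- t) 1# ≈ 2 (a t² + c').
          2[t²+κ]≈σ[t²-1] : (1# + 1#) * (t * t + κ) ≈ σ * (t * t - 1#)
          2[t²+κ]≈σ[t²-1] = *-cancelˡ-nonzero a≉0
            (linear-combination₃ 1# 1# ((ν₁ + ν₂) * (t * t - 1#) - (1# + 1#))
              (solve 7 (λ a b c t κ ν₁ ν₂ →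
                  a :* (2ₚ :* (t :* t :+ κ)) :- a :* ((ν₁ :+ ν₂) :* (κ :- 1ₚ) :* (t :* t :- 1ₚ))
                  := 1ₚ :* (quadFormₚ a b c t 1ₚ :- ν₁ :* ((c :- a) :* (t :* t :- 1ₚ)))
                     :+ 1ₚ :* (quadFormₚ a b c (:- t) 1ₚ :- ν₂ :* ((c :- a) :* ((:- t) :* (:- t) :- 1ₚ)))
                     :+ ((ν₁ :+ ν₂) :* (t :* t :- 1ₚ) :- 2ₚ) :* (c :- κ :* a))
                refl a b c' t κ ν₁ ν₂)
              e₁ e₂ c≈κa)
          relation : ((1# + 1#) - σ) * (t * t) + ((1# + 1#) * κ + σ) ≈ 0#
          relation = linear-combination₁ 1#
            (solve 3 (λ t κ σ → (2ₚ :- σ) :* (t :* t) :+ (2ₚ :* κ :+ σ) :- 0ₚ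
                       := 1ₚ :* (2ₚ :* (t :* t :+ κ) :- σ :* (t :* t :- 1ₚ)))
                   refl t κ σ)
            2[t²+κ]≈σ[t²-1]
          κ+1≈0 : (1# + 1#) - σ ≈ 0# × (1# + 1#) * κ + σ ≈ 0# → κ + 1# ≈ 0#
          κ+1≈0 (A≈0 , B≈0) = 2x≈0⇒x≈0 (linear-combination₂ 1# 1#
            (solve 2 (λ κ σ → 2ₚ :* (κ :+ 1ₚ) :- 0ₚ
                       := 1ₚ :* (2ₚ :- σ :- 0ₚ) :+ 1ₚ :* (2ₚ :* κ :+ σ :- 0ₚ))
                   refl κ σ)
            A≈0 B≈0)

      κ+1≈0 : κ + 1# ≈ 0#
      κ+1≈0 = from-cases (square∈K⊎κ≈-1 u∉K) (square∈K⊎κ≈-1 (∉K-+ u∉K K.one∈))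
        where
        from-cases : K (u * u) ⊎ κ + 1# ≈ 0# → K ((u + 1#) * (u + 1#)) ⊎ κ + 1# ≈ 0# → κ + 1# ≈ 0#
        from-cases (inj₂ κ+1≈0) _                = κ+1≈0
        from-cases (inj₁ _)     (inj₂ κ+1≈0)     = κ+1≈0
        from-cases (inj₁ u²∈K)  (inj₁ [u+1]²∈K) =
          contradiction (squares∈K⇒∈K u²∈K [u+1]²∈K) u∉K

      c+a≈0 : c' + a ≈ 0#
      c+a≈0 = linear-combination₂ 1# a
        (solve 3 (λ a c κ → c :+ a :- 0ₚ := 1ₚ :* (c :- κ :* a) :+ a :* (κ :+ 1ₚ :- 0ₚ)) refl a c' κ)
        c≈κa κ+1≈0

      bs∈⟨a[s²-1]⟩ : ∀ {s} → ¬ s * s ≈ 1# → b * s ∈ ⟨ a * (s * s - 1#) ⟩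
      bs∈⟨a[s²-1]⟩ {s} s²≉1 = from-ratio (Q[s,1]∈⟨[c-a][s²-1]⟩ s²≉1)
        where
        from-ratio : Q s 1# ∈ ⟨ (c' - a) * (s * s - 1#) ⟩ → b * s ∈ ⟨ a * (s * s - 1#) ⟩
        from-ratio (ν , ν∈K , e) = - ((1# + 1#) * ν + 1#) , K.-∈ (K.+∈ (K.*∈ 2∈K ν∈K) K.one∈) ,
          linear-combination₂ 1# (ν * (s * s - 1#) - 1#)
            (solve 5 (λ a b c s ν → b :* s :- (:- (2ₚ :* ν :+ 1ₚ)) :* (a :* (s :* s :- 1ₚ))
                       := 1ₚ :* (quadFormₚ a b c s 1ₚ :- ν :* ((c :- a) :* (s :* s :- 1ₚ)))
                          :+ (ν :* (s :* s :- 1ₚ) :- 1ₚ) :* (c :+ a :- 0ₚ))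
                   refl a b c' s ν)
            e c+a≈0

      t²+1∈⟨t⟩ : ¬ b ≈ 0# → ∀ {t} → ¬ K t → t * t + 1# ∈ ⟨ t ⟩
      t²+1∈⟨t⟩ b≉0 {t} t∉K with (t * t) ≟ (- 1#)
      ... | yes t²≈-1 = 0# , K.zero∈ , linear-combination₁ 1#
            (solve 1 (λ t → t :* t :+ 1ₚ :- 0ₚ :* t := 1ₚ :* (t :* t :- (:- 1ₚ))) refl t) t²≈-1
      ... | no t²≉-1 =
        from-ratios (bs∈⟨a[s²-1]⟩ (∉K⇒square≉1 t∉K)) (bs∈⟨a[s²-1]⟩ (∉K⇒t⁴≉1 t∉K t²≉-1))
        where
        from-ratios : b * t ∈ ⟨ a * (t * t - 1#) ⟩ → b * (t * t) ∈ ⟨ a * ((t * t) * (t * t) - 1#) ⟩ →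
                      t * t + 1# ∈ ⟨ t ⟩
        from-ratios (m₁ , m₁∈K , e₁) (m₂ , m₂∈K , e₂) =
          ∈⟨⟩-trans (∈⟨⟩-cancelˡ m₂∈K m₂≉0 (sym m₁t≈m₂[t²+1])) (m₁ , m₁∈K , refl)
          where
          -- Multiply the relation at t by t and compare it with the one at t², using
          -- t⁴ - 1 = (t² - 1)(t² + 1).
          m₁t≈m₂[t²+1] : m₁ * t ≈ m₂ * (t * t + 1#)
          m₁t≈m₂[t²+1] =
            *-cancelˡ-nonzero (*-nonzero a≉0 (∉K⇒square≉1 t∉K ∘ x∙y⁻¹≈ε⇒x≈y (t * t) 1#))
              (linear-combination₂ (- t) 1#
                (solve 5 (λ a b t m₁ m₂ →
                    a :* (t :* t :- 1ₚ) :* (m₁ :* t) :- a :* (t :* t :- 1ₚ) :* (m₂ :* (t :* t :+ 1ₚ))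
                    := (:- t) :* (b :* t :- m₁ :* (a :* (t :* t :- 1ₚ)))
                       :+ 1ₚ :* (b :* (t :* t) :- m₂ :* (a :* ((t :* t) :* (t :* t) :- 1ₚ))))
                  refl a b t m₁ m₂)
                e₁ e₂)
          m₂≉0 : ¬ m₂ ≈ 0#
          m₂≉0 = factorˡ≉0 (sym e₂) (*-nonzero b≉0 (*-nonzero (∉K⇒≉0 t∉K) (∉K⇒≉0 t∉K)))

      b≈0 : b ≈ 0#
      b≈0 with b ≟ 0#
      ... | yes b≈0 = b≈0
      ... | no b≉0  = contradiction
        (reciprocal-sums∈K⇒∈K (t²+1∈⟨t⟩ b≉0 (∉K-+ u∉K K.one∈)) (t²+1∈⟨t⟩ b≉0 (∉K-+ u∉K (K.-∈ K.one∈))))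
        u∉K

      skew-symmetric : b ≈ 0# × a ≈ - c' × ¬ a ≈ 0#
      skew-symmetric = b≈0 , +-inverseʳ-unique c' a c+a≈0 , a≉0

module Parity where
  open import Data.Nat using (_+_; _*_)

  ascent : ∀ {m} → Fin m → Fin m → ℕ
  ascent i j = if does (i Fin.<? j) then 1 else 0

  ascent-+-swap : ∀ {m} {i j : Fin m} → i ≢ j → ascent i j + ascent j i ≡ 1
  ascent-+-swap {i = i} {j} i≢j with Fin.<-cmp i j
  ... | tri< i<j _ j≮i rewrite dec-true (i Fin.<? j) i<j | dec-false (j Fin.<? i) j≮i = ≡.refl
  ... | tri≈ _ i≡j _ = contradiction i≡j i≢j
  ... | tri> i≮j _ j<i rewrite dec-false (i Fin.<? j) i≮j | dec-true (j Fin.<? i) j<i = ≡.refl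

  ∑-const-1 : ∀ m → ∑[ i < m ] 1 ≡ m
  ∑-const-1 zero = ≡.refl
  ∑-const-1 (suc m) = ≡.cong suc (∑-const-1 m)

  -- Every pair {i , σ i} contributes exactly one ascent, so m is twice the number of ascents.
  fixedPointFree-involution⇒even : ∀ {m} (σ : Fin m → Fin m) →
    (∀ i → σ (σ i) ≡ i) → (∀ i → σ i ≢ i) → 2 ∣ m
  fixedPointFree-involution⇒even {m} σ σ-involutive σ-fixedPointFree = divides ups (begin
    m                            ≡⟨ ∑-const-1 m ⟨
    ∑[ i < m ] 1                 ≡⟨ sum-cong-≗ (ascent-+-swap ∘ (_∘ ≡.sym) ∘ σ-fixedPointFree) ⟨
    ∑[ i < m ] (up i + down i)   ≡⟨ ∑-distrib-+ up down ⟩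
    ups + ∑[ i < m ] down i      ≡⟨ ≡.cong (ups ℕ.+_) downs≡ups ⟩
    ups + ups                    ≡⟨ ≡.cong (ups ℕ.+_) (ℕ.+-identityʳ ups) ⟨
    2 * ups                      ≡⟨ ℕ.*-comm 2 ups ⟩
    ups * 2                      ∎)
    where
    open ≡.≡-Reasoning
    up down : Fin m → ℕ
    up i = ascent i (σ i)
    down i = ascent (σ i) i
    ups : ℕ
    ups = ∑[ i < m ] up i
    downs≡ups : ∑[ i < m ] down i ≡ ups
    downs≡ups = begin
      ∑[ i < m ] down i     ≡⟨ sum-cong-≗ (≡.cong (ascent (σ _)) ∘ σ-involutive) ⟨
      ∑[ i < m ] up (σ i)   ≡⟨ ∑-permute up (Permutation.permutation σ σ σ-involutive σ-involutive) ⟨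
      ups                   ∎

  ¬2∣p⇒¬2∣p^k : ∀ {p} → ¬ 2 ∣ p → ∀ k → ¬ 2 ∣ p ℕ.^ k
  ¬2∣p⇒¬2∣p^k p-odd zero    2∣1 = contradiction (∣1⇒≡1 2∣1) λ ()
  ¬2∣p⇒¬2∣p^k p-odd (suc k) 2∣p^[1+k] =
    [ p-odd , ¬2∣p⇒¬2∣p^k p-odd k ]′ (euclidsLemma _ _ prime[2] 2∣p^[1+k])

module FiniteSubfield {c ℓ k} (L : CommutativeRing c ℓ) (K : Pred (CommutativeRing.Carrier L) k)
  (isK : IsSubfield L K) {N q : ℕ}
  (cardL : HasCard L (CommutativeRing.setoid L) N) (cardK : HasCard L (subSetoid L K) q) where
  open CommutativeRing L
  open import Algebra.Properties.Ring ring using (+-identityʳ-unique)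
  open import Relation.Binary.Reasoning.Setoid setoid
  module K = IsSubfield isK
  module L↔ = Inverse cardL
  module K↔ = Inverse cardK

  _≟_ : Decidable _≈_
  x ≟ y = map′ (λ e → trans (sym (L↔.strictlyInverseʳ x)) (L↔.inverseʳ e)) L↔.to-cong
               (L↔.to x Fin.≟ L↔.to y)

  K? : Unary.Decidable K
  K? x = map′ (λ (j , e) → K.resp e (proj₂ (K↔.from j)))
              (λ x∈K → K↔.to (x , x∈K) , K↔.strictlyInverseʳ (x , x∈K))
              (Fin.any? λ j → proj₁ (K↔.from j) ≟ x)

  ∃∉K : q ℕ.< N → Σ Carrier λ u → ¬ K u
  ∃∉K q<N = Product.map L↔.from id (Fin.¬∀⟶∃¬ N (K ∘ L↔.from) (K? ∘ L↔.from) not-all∈K)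
    where
    not-all∈K : ¬ (∀ i → K (L↔.from i))
    not-all∈K all∈K =
      let (i , j , i<j , same) = Fin.pigeonhole q<N (λ i → K↔.to (L↔.from i , all∈K i))
          from-i≈from-j = trans (sym (K↔.strictlyInverseʳ _)) (K↔.inverseʳ same)
      in Fin.<-irrefl (≡.trans (≡.sym (L↔.strictlyInverseˡ i)) (L↔.inverseˡ from-i≈from-j)) i<j

  1+1≈0⇒2∣q : ¬ 1# ≈ 0# → 1# + 1# ≈ 0# → 2 ∣ q
  1+1≈0⇒2∣q 1≉0 2≈0 = Parity.fixedPointFree-involution⇒even σ σ-involutive σ-fixedPointFree
    where
    element : Fin q → Carrier
    element j = proj₁ (K↔.from j)
    σ : Fin q → Fin q
    σ j = K↔.to (element j + 1# , K.+∈ (proj₂ (K↔.from j)) K.one∈)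
    element-σ : ∀ j → element (σ j) ≈ element j + 1#
    element-σ j = K↔.strictlyInverseʳ (element j + 1# , K.+∈ (proj₂ (K↔.from j)) K.one∈)
    σ-involutive : ∀ j → σ (σ j) ≡ j
    σ-involutive j = K↔.inverseˡ (begin
      element (σ j) + 1#          ≈⟨ +-congʳ (element-σ j) ⟩
      (element j + 1#) + 1#       ≈⟨ +-assoc (element j) 1# 1# ⟩
      element j + (1# + 1#)       ≈⟨ +-congˡ 2≈0 ⟩
      element j + 0#              ≈⟨ +-identityʳ (element j) ⟩
      element j                   ∎)
    σ-fixedPointFree : ∀ j → σ j ≢ j
    σ-fixedPointFree j σj≡j = 1≉0 (+-identityʳ-unique (element j) 1#
      (trans (sym (element-σ j)) (reflexive (≡.cong element σj≡j))))

theorem1p2 : ∀ {c ℓ k : Level} (q n : ℕ) → OddPrimePower q → 2 ℕ.≤ n →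
    (L : CommutativeRing c ℓ) → IsField L →
    HasCard L (CommutativeRing.setoid L) (q ℕ.^ n) →
    (K : Pred (CommutativeRing.Carrier L) k) → IsSubfield L K →
    HasCard L (subSetoid L K) q →
    (a b c' : CommutativeRing.Carrier L) →
    ¬ (CommutativeRing._≈_ L a (CommutativeRing.0# L)
    × CommutativeRing._≈_ L b (CommutativeRing.0# L)
    × CommutativeRing._≈_ L c' (CommutativeRing.0# L)) →
    UndirectedForAllSubspaces L (c ⊔ ℓ ⊔ k) K a b c' ⇔ CoeffCondition L a b c'
theorem1p2 {c} {ℓ} {k} q n (p , r , p-prime , p-odd , 1≤r , q≡p^r) 2≤n L isField cardL K isK cardK
           a b c' _ = mk⇔ forward (Lines.coeffCondition⇒undirected L K isK)
  where
  open CommutativeRing L using (1#; 0#; _+_; _≈_)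
  open FiniteSubfield L K isK cardL cardK
  open DecidableSubfield L isField _≟_ K isK using (module SwapProportionalForm)

  1<q : 1 ℕ.< q
  1<q = ≡.subst (1 ℕ.<_) (≡.sym q≡p^r)
          (ℕ.^-monoʳ-< p (ℕ.nonTrivial⇒n>1 p {{prime⇒nonTrivial p-prime}}) 1≤r)

  q<q^n : q ℕ.< q ℕ.^ n
  q<q^n = ≡.subst (ℕ._< q ℕ.^ n) (ℕ.^-identityʳ q) (ℕ.^-monoʳ-< q 1<q 2≤n)

  2≉0 : ¬ 1# + 1# ≈ 0#
  2≉0 = Parity.¬2∣p⇒¬2∣p^k p-odd r ∘ ≡.subst (2 ∣_) q≡p^r ∘ 1+1≈0⇒2∣q (proj₁ isField)

  forward : UndirectedForAllSubspaces L (c ⊔ ℓ ⊔ k) K a b c' → CoeffCondition L a b c'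
  forward undirected with a ≟ c'
  ... | yes a≈c' = inj₁ a≈c'
  ... | no a≉c'  = inj₂ (SwapProportionalForm.skew-symmetric 2≉0 (proj₂ (∃∉K q<q^n))
                           (Lines.undirected⇒swapProportional L K isK undirected) a≉c')
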